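{- For every integer $n\ge2$, $\Upsilon(K_{1,n})=[n]$, where $K_{1,n}$ is the star graph with $n+1$ vertices.
   Context: All graphs are finite and simple. For a positive integer $p$ and a digraph $D=(V,A)$ with $A\subseteq V\times V$ (loops allowed), the $p$-competition graph $C_p(D)$ has vertex set $V$, and distinct $x,y$ are adjacent iff there are $p$ distinct vertices $a_1,\dots,a_p\in V$ with $(x,a_i),(y,a_i)\in A$ for all $i$. A graph is a $p$-competition graph if it equals $C_p(D)$ for some digraph $D$. For a graph $G$ with $N$ vertices, $\Upsilon(G)=\{p\in\{1,\dots,N\}\mid G\text{ is a }p\text{ -competition graph}\}$; $[n]=\{1,\dots,n\}$. -}

module Defs where

open import Data.Nat using (ℕ; suc; _≤_)
open import Data.Fin using (Fin; zero)
open import Data.Product using (Σ; _×_; _,_)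
open import Data.Sum using (_⊎_; inj₁; inj₂)
open import Relation.Binary.PropositionalEquality using (_≡_; _≢_)
open import Relation.Nullary using (¬_)
open import Function.Definitions using (Injective)
open import Function.Bundles using (_⇔_)

record Graph (N : ℕ) : Set₁ where
  field
    Adj   : Fin N → Fin N → Set
    sym   : ∀ {x y} → Adj x y → Adj y x
    irrefl : ∀ {x} → ¬ Adj x x
open Graph public

Digraph : ℕ → Set₁
Digraph N = Fin N → Fin N → Set

CompAdj : {N : ℕ} → ℕ → Digraph N → Fin N → Fin N → Set
CompAdj {N} p D x y =
  x ≢ y × Σ (Fin p → Fin N) (λ a → Injective _≡_ _≡_ a × (∀ i → D x (a i) × D y (a i)))

IsCompOf : {N : ℕ} → ℕ → Graph N → Digraph N → Set
IsCompOf p G D = ∀ x y → Adj G x y ⇔ CompAdj p D x y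

IsPCompetition : {N : ℕ} → ℕ → Graph N → Set₁
IsPCompetition {N} p G = Σ (Digraph N) (λ D → IsCompOf p G D)

InΥ : {N : ℕ} → Graph N → ℕ → Set₁
InΥ {N} G p = (1 ≤ p × p ≤ N) × IsPCompetition p G

StarAdj : (n : ℕ) → Fin (suc n) → Fin (suc n) → Set
StarAdj n x y = (x ≡ zero × y ≢ zero) ⊎ (y ≡ zero × x ≢ zero)

private
  starSym : (n : ℕ) → ∀ {x y} → StarAdj n x y → StarAdj n y x
  starSym n (inj₁ p) = inj₂ p
  starSym n (inj₂ p) = inj₁ p

  starIrr : (n : ℕ) → ∀ {x} → ¬ StarAdj n x x
  starIrr n (inj₁ (e , ne)) = ne e
  starIrr n (inj₂ (e , ne)) = ne e

Star : (n : ℕ) → Graph (suc n)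
Star n = record { Adj = StarAdj n ; sym = starSym n ; irrefl = starIrr n }

-- Upper bound: in C_{N}(D) on N vertices two vertices are adjacent only if both
-- dominate every vertex, so the neighbours of any vertex are pairwise adjacent;
-- a star with two leaves is not of this form.  Lower bound: for 1 ≤ p ≤ n let the
-- centre dominate everything and give the n leaves pairwise distinct p-element
-- out-neighbourhoods.  The centre and a leaf then share exactly p out-neighbours,
-- while two leaves sharing p out-neighbours would force their out-neighbourhoods,
-- being p-sets, to coincide.
module Submission where

open import Defs hiding (sym)
open import Data.Nat using (ℕ; zero; suc; _+_; _≤_; s≤s; s≤s⁻¹)
open import Data.Nat.Properties using (1+n≰n; m≤n⇒m≤1+n; m≤n⇒m<n∨m≡n; m≤n⇒∃[o]m+o≡n)
open import Data.Fin using (Fin; zero; suc; punchIn; punchOut; _↑ˡ_; _↑ʳ_; splitAt; join)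
open import Data.Fin.Properties
  using (_≟_; any?; injective⇒≤; suc-injective; punchOut-injective; punchIn-injective;
         punchInᵢ≢i; punchIn-punchOut; ↑ˡ-injective; ↑ʳ-injective; splitAt-↑ˡ; splitAt-↑ʳ;
         join-splitAt)
open import Data.Product using (_×_; _,_; proj₁; proj₂; ∃)
open import Data.Sum using (_⊎_; inj₁; inj₂; [_,_]′)
open import Data.Unit using (⊤; tt)
open import Relation.Nullary using (¬_; yes; no; contradiction)
open import Relation.Binary.PropositionalEquality
  using (_≡_; _≢_; refl; sym; trans; cong; module ≡-Reasoning)
open import Function.Definitions using (Injective)
open import Function.Bundles using (Equivalence; mk⇔)

private
  variable
    m m′ n N p : ℕ

_∈Im_ : Fin N → (Fin m → Fin N) → Set
k ∈Im f = ∃ λ i → f i ≡ k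

_⊆Im_ : (Fin m → Fin N) → (Fin m′ → Fin N) → Set
f ⊆Im g = ∀ i → f i ∈Im g

injective⇒surjective : {f : Fin n → Fin n} → Injective _≡_ _≡_ f → ∀ k → k ∈Im f
injective⇒surjective {zero} _ ()
injective⇒surjective {suc n} {f} f-inj k with any? (λ i → f i ≟ k)
... | yes k∈f = k∈f
... | no  k∉f = contradiction (injective⇒≤ g-inj) 1+n≰n
  where
  k≢f : ∀ i → k ≢ f i
  k≢f i k≡fi = k∉f (i , sym k≡fi)
  g-inj : Injective _≡_ _≡_ (λ i → punchOut (k≢f i))
  g-inj eq = f-inj (punchOut-injective (k≢f _) (k≢f _) eq)

injective-⊆Im⇒⊇Im : {a e : Fin p → Fin N} → Injective _≡_ _≡_ a → a ⊆Im e → e ⊆Im a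
injective-⊆Im⇒⊇Im {a = a} {e} a-inj a⊆e j =
  let i , σi≡j = injective⇒surjective σ-inj j
  in  i , trans (sym (proj₂ (a⊆e i))) (cong e σi≡j)
  where
  σ : Fin _ → Fin _
  σ i = proj₁ (a⊆e i)
  σ-inj : Injective _≡_ _≡_ σ
  σ-inj {i} {i′} σi≡σi′ =
    a-inj (trans (sym (proj₂ (a⊆e i))) (trans (cong e σi≡σi′) (proj₂ (a⊆e i′))))

compAdj-sym : {D : Digraph N} {x y : Fin N} → CompAdj p D x y → CompAdj p D y x
compAdj-sym (x≢y , a , a-inj , shared) =
  (λ y≡x → x≢y (sym y≡x)) , a , a-inj , λ i → proj₂ (shared i) , proj₁ (shared i)

compAdj-covers : {D : Digraph N} {x y : Fin N} (e : Fin p → Fin N) →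
                 (∀ {k} → D x k → k ∈Im e) → CompAdj p D x y → ∀ j → D y (e j)
compAdj-covers e out⊆e (_ , a , a-inj , shared) j
  with injective-⊆Im⇒⊇Im a-inj (λ i → out⊆e (proj₁ (shared i))) j
... | i , eq rewrite sym eq = proj₂ (shared i)

fullCompAdj⇒total : {D : Digraph N} {x y : Fin N} → CompAdj N D x y → ∀ k → D y k
fullCompAdj⇒total {D = D} = compAdj-covers {D = D} (λ k → k) (λ {k} _ → k , refl)

fullCompAdj-trans : {D : Digraph N} {x y z : Fin N} →
                    CompAdj N D x y → CompAdj N D x z → y ≢ z → CompAdj N D y z
fullCompAdj-trans {D = D} x~y x~z y≢z with compAdj-sym {D = D} x~y
... | _ , a , a-inj , shared =
  y≢z , a , a-inj , λ i → proj₁ (shared i) , fullCompAdj⇒total {D = D} x~z (a i)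

star-not-full : 2 ≤ n → ¬ IsPCompetition (suc n) (Star n)
star-not-full {suc zero} (s≤s ())
star-not-full {suc (suc n)} _ (D , C⇔Star) = not-star-edge (Equivalence.from (C⇔Star one two) one~two)
  where
  one two : Fin (suc (suc (suc n)))
  one = suc zero
  two = suc (suc zero)
  centre~ : ∀ x → x ≢ zero → CompAdj (suc (suc (suc n))) D zero x
  centre~ x x≢0 = Equivalence.to (C⇔Star zero x) (inj₁ (refl , x≢0))
  one~two : CompAdj (suc (suc (suc n))) D one two
  one~two = fullCompAdj-trans {D = D} (centre~ one λ ()) (centre~ two λ ()) λ ()
  not-star-edge : ¬ StarAdj (suc (suc n)) one two
  not-star-edge (inj₁ (() , _))
  not-star-edge (inj₂ (() , _))

starDigraph : (Fin n → Fin p → Fin (suc n)) → Digraph (suc n)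
starDigraph S zero    k = ⊤
starDigraph S (suc x) k = k ∈Im S x

star-isCompOf : (S : Fin n → Fin p → Fin (suc n)) → (∀ x → Injective _≡_ _≡_ (S x)) →
                (∀ {x y} → S x ⊆Im S y → S y ⊆Im S x → x ≡ y) →
                IsCompOf p (Star n) (starDigraph S)
star-isCompOf {n} {p} S S-inj S-distinct x y = mk⇔ (star⇒comp x y) (comp⇒star x y)
  where
  D = starDigraph S
  centre~leaf : ∀ x → CompAdj p D zero (suc x)
  centre~leaf x = (λ ()) , S x , S-inj x , λ i → tt , i , refl
  leaf~leaf⇒⊆Im : ∀ {x y} → CompAdj p D (suc x) (suc y) → S x ⊆Im S y
  leaf~leaf⇒⊆Im {x} = compAdj-covers {D = D} (S x) (λ k∈Sx → k∈Sx)
  star⇒comp : ∀ x y → StarAdj n x y → CompAdj p D x y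
  star⇒comp zero    zero    adj = contradiction adj (irrefl (Star n))
  star⇒comp zero    (suc y) _   = centre~leaf y
  star⇒comp (suc x) zero    _   = compAdj-sym {D = D} (centre~leaf x)
  star⇒comp (suc x) (suc y) (inj₁ (() , _))
  star⇒comp (suc x) (suc y) (inj₂ (() , _))
  comp⇒star : ∀ x y → CompAdj p D x y → StarAdj n x y
  comp⇒star zero    zero    (0≢0 , _) = contradiction refl 0≢0
  comp⇒star zero    (suc y) _         = inj₁ (refl , λ ())
  comp⇒star (suc x) zero    _         = inj₂ (refl , λ ())
  comp⇒star (suc x) (suc y) x~y       = contradiction (cong suc x≡y) (proj₁ x~y)
    where
    x≡y = S-distinct (leaf~leaf⇒⊆Im x~y) (leaf~leaf⇒⊆Im (compAdj-sym {D = D} x~y))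

⊆Im-cancelˡ : {h : Fin N → Fin m} {f : Fin p → Fin N} {g : Fin n → Fin N} →
              Injective _≡_ _≡_ h → (λ i → h (f i)) ⊆Im (λ i → h (g i)) → f ⊆Im g
⊆Im-cancelˡ h-inj hf⊆hg i = let j , eq = hf⊆hg i in j , h-inj eq

punchIn-⊆Im⇒≡ : (i j : Fin (suc n)) → punchIn i ⊆Im punchIn j → i ≡ j
punchIn-⊆Im⇒≡ i j i⊆j with i ≟ j
... | yes i≡j = i≡j
... | no  i≢j =
  let k , eq = i⊆j (punchOut i≢j)
  in  contradiction (trans eq (punchIn-punchOut i≢j)) (punchInᵢ≢i j k)

↑ˡ≢↑ʳ : (i : Fin m) (j : Fin n) → i ↑ˡ n ≢ m ↑ʳ j
↑ˡ≢↑ʳ {m} {n} i j eq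
  with trans (sym (splitAt-↑ˡ m i n)) (trans (cong (splitAt m) eq) (splitAt-↑ʳ m n j))
... | ()

-- For p = q + 1 and n = p + r: the p-subsets {0,…,p} ∖ {i + 1} of Fin (n + 1) for
-- i < p, and {2,…,p} ∪ {p + 1 + j} for j < r.
module _ (q r : ℕ) where

  lowSet : Fin (suc q) → Fin (suc q) → Fin (suc (suc q) + r)
  lowSet i k = punchIn (suc i) k ↑ˡ r

  highSet : Fin r → Fin (suc q) → Fin (suc (suc q) + r)
  highSet j zero    = suc (suc q) ↑ʳ j
  highSet j (suc k) = suc (suc k) ↑ˡ r

  leafSet : Fin (suc q) ⊎ Fin r → Fin (suc q) → Fin (suc (suc q) + r)
  leafSet = [ lowSet , highSet ]′

  leafSet-injective : ∀ u → Injective _≡_ _≡_ (leafSet u)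
  leafSet-injective (inj₁ i) eq = punchIn-injective (suc i) _ _ (↑ˡ-injective r _ _ eq)
  leafSet-injective (inj₂ j) {zero}  {zero}   _  = refl
  leafSet-injective (inj₂ j) {zero}  {suc k′} eq = contradiction (sym eq) (↑ˡ≢↑ʳ _ _)
  leafSet-injective (inj₂ j) {suc k} {zero}   eq = contradiction eq (↑ˡ≢↑ʳ _ _)
  leafSet-injective (inj₂ j) {suc k} {suc k′} eq =
    cong suc (suc-injective (suc-injective (↑ˡ-injective r _ _ eq)))

  leafSet-distinct : ∀ u v → leafSet u ⊆Im leafSet v → leafSet v ⊆Im leafSet u → u ≡ v
  leafSet-distinct (inj₁ i) (inj₁ i′) u⊆v _ =
    cong inj₁ (suc-injective (punchIn-⊆Im⇒≡ (suc i) (suc i′) (⊆Im-cancelˡ (↑ˡ-injective r _ _) u⊆v)))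
  leafSet-distinct (inj₁ i) (inj₂ j) _ v⊆u = contradiction (proj₂ (v⊆u zero)) (↑ˡ≢↑ʳ _ _)
  leafSet-distinct (inj₂ j) (inj₁ i) u⊆v _ = contradiction (proj₂ (u⊆v zero)) (↑ˡ≢↑ʳ _ _)
  leafSet-distinct (inj₂ j) (inj₂ j′) u⊆v _ with u⊆v zero
  ... | zero  , eq = cong inj₂ (sym (↑ʳ-injective _ _ _ eq))
  ... | suc k , eq = contradiction eq (↑ˡ≢↑ʳ _ _)

star-isPCompetition : 1 ≤ p → p ≤ n → IsPCompetition p (Star n)
star-isPCompetition {suc q} _ p≤n with m≤n⇒∃[o]m+o≡n p≤n
... | r , refl = starDigraph S , star-isCompOf S (λ x → leafSet-injective q r (split x)) S-distinct
  where
  split = splitAt (suc q)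
  S : Fin (suc q + r) → Fin (suc q) → Fin (suc (suc q) + r)
  S x = leafSet q r (split x)
  S-distinct : ∀ {x y} → S x ⊆Im S y → S y ⊆Im S x → x ≡ y
  S-distinct {x} {y} x⊆y y⊆x = begin
    x                               ≡⟨ join-splitAt (suc q) r x ⟨
    join (suc q) r (split x)        ≡⟨ cong (join (suc q) r) (leafSet-distinct q r (split x) (split y) x⊆y y⊆x) ⟩
    join (suc q) r (split y)        ≡⟨ join-splitAt (suc q) r y ⟩
    y                               ∎
    where open ≡-Reasoning

mainTheorem11 : (n : ℕ) → 2 ≤ n → ∀ (p : ℕ) → (InΥ (Star n) p → (1 ≤ p × p ≤ n)) × ((1 ≤ p × p ≤ n) → InΥ (Star n) p)
mainTheorem11 n n≥2 p = necessary , sufficient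
  where
  necessary : InΥ (Star n) p → 1 ≤ p × p ≤ n
  necessary ((1≤p , p≤1+n) , p-comp) with m≤n⇒m<n∨m≡n p≤1+n
  ... | inj₁ p<1+n = 1≤p , s≤s⁻¹ p<1+n
  ... | inj₂ refl  = contradiction p-comp (star-not-full n≥2)
  sufficient : 1 ≤ p × p ≤ n → InΥ (Star n) p
  sufficient (1≤p , p≤n) = (1≤p , m≤n⇒m≤1+n p≤n) , star-isPCompetition 1≤p p≤n
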